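{- Let $G$ be a graph and let $\mathcal{H}=(L,H)$ be an $m$-fold cover of $G$ with $m\geq 2$. Let $e=uv\in E(G)$, and let $H'=H-E_H(L(u),L(v))$, so that $\mathcal{H}'=(L,H')$ is an $m$-fold cover of $G-\{e\}$. Suppose there is a natural bijection between the $\mathcal{H}'$-colorings of $G-\{e\}$ and the proper $m$-colorings of $G-\{e\}$. Then $$P_{DP}(G,\mathcal{H})\geq P(G-\{e\},m)-\max\left\{P(G-\{e\},m)-P(G,m),\ \frac{P(G,m)}{m-1}\right\}.$$ Moreover, there exists an $m$-fold cover $\mathcal{H}^*=(L,H^*)$ of $G$ such that $$P_{DP}(G,\mathcal{H}^*)= P(G-\{e\},m)-\max\left\{P(G-\{e\},m)-P(G,m),\ \frac{P(G,m)}{m-1}\right\}.$$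
   Context: All graphs are finite and simple; $G-\{e\}$ is $G$ with edge $e$ deleted; $[m]=\{1,\dots,m\}$. For $m\in\mathbb{N}$, $P(G,m)$ denotes the number of proper $m$-colorings of $G$. A cover of a graph $G$ is a pair $\mathcal{H}=(L,H)$ where $H$ is a graph and $L:V(G)\to\mathcal{P}(V(H))$ satisfies: (1) the sets $L(u)$, $u\in V(G)$, partition $V(H)$; (2) each $H[L(u)]$ is complete; (3) if $E_H(L(u),L(v))$ is nonempty then $u=v$ or $uv\in E(G)$; (4) if $uv\in E(G)$ then $E_H(L(u),L(v))$ is a matching (possibly empty). Here $E_H(S,U)$ is the set of edges of $H$ with one endpoint in $S$ and one in $U$. The cover is $m$-fold if $|L(u)|=m$ for all $u$. An $\mathcal{H}$-coloring of $G$ is an independent set of $H$ of size $|V(G)|$; $P_{DP}(G,\mathcal{H})$ is the number of $\mathcal{H}$-colorings. For an $m$-fold cover $\mathcal{H}=(L,H)$ of a graph $G$, there is a natural bijection between the $\mathcal{H}$-colorings of $G$ and the proper $m$-colorings of $G$ if the elements of each $L(v)$ can be named $L(v)=\{(v,j):j\in[m]\}$ so that whenever $xy\in E(G)$, $(x,j)$ and $(y,j)$ are adjacent in $H$ for every $j\in[m]$. -}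

module Defs where

open import Data.Bool using (Bool; true; false; _∧_; _∨_; not; if_then_else_)
open import Data.Nat using (ℕ; zero; suc; _≤_; s≤s; z≤n)
open import Data.Fin using (Fin; zero; suc; _≟_)
open import Data.List using (List; []; _∷_; map; concatMap; length; filterᵇ; allFin)
open import Data.Bool.ListAction using (and)
open import Data.Nat.ListAction using (sum)
open import Data.Vec.Functional using () renaming (_∷_ to _∷ᶠ_)
open import Data.Product using (_×_; _,_)
open import Relation.Nullary using (¬_)
open import Relation.Nullary.Decidable using (⌊_⌋)
open import Relation.Binary.PropositionalEquality using (_≡_; _≢_)
open import Data.Fin.Permutation using (Permutation′; _⟨$⟩ʳ_)
open import Data.Integer using (+_)
open import Data.Rational using (ℚ; _/_; _-_; _⊔_)

Graph : ℕ → Set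
Graph n = Fin n → Fin n → Bool

record IsSimple {n : ℕ} (G : Graph n) : Set where
  field
    sym     : ∀ x y → G x y ≡ G y x
    irrefl  : ∀ x → G x x ≡ false

deleteEdge : {n : ℕ} → Graph n → Fin n → Fin n → Graph n
deleteEdge G u v x y =
  G x y ∧ not ((⌊ x ≟ u ⌋ ∧ ⌊ y ≟ v ⌋) ∨ (⌊ x ≟ v ⌋ ∧ ⌊ y ≟ u ⌋))

allFuns : {A : Set} (k : ℕ) → List A → List (Fin k → A)
allFuns zero    xs = (λ ()) ∷ []
allFuns (suc k) xs = concatMap (λ a → map (λ f → a ∷ᶠ f) (allFuns k xs)) xs

count : {A : Set} → (A → Bool) → List A → ℕ
count p xs = length (filterᵇ p xs)

allB : {A : Set} → List A → (A → Bool) → Bool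
allB xs p = and (map p xs)

isProper : {n m : ℕ} → Graph n → (Fin n → Fin m) → Bool
isProper {n} G c =
  allB (allFin n) λ x → allB (allFin n) λ y →
    not (G x y ∧ ⌊ c x ≟ c y ⌋)

P : {n : ℕ} → Graph n → (m : ℕ) → ℕ
P {n} G m = count (isProper G) (allFuns n (allFin m))

-- m-fold covers.  The vertex set of H is Fin n × Fin m and
-- L(u) = { (u , i) : i ∈ Fin m }, so (1) holds by construction and
-- |L(u)| = m.  H is given by its Boolean adjacency.

CoverGraph : ℕ → ℕ → Set
CoverGraph n m = Fin n × Fin m → Fin n × Fin m → Bool

record IsCover {n m : ℕ} (G : Graph n) (H : CoverGraph n m) : Set where
  field
    sym      : ∀ a b → H a b ≡ H b a
    irrefl   : ∀ a → H a a ≡ false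
    clique   : ∀ u i j → i ≢ j → H (u , i) (u , j) ≡ true
    respects : ∀ u v i j → u ≢ v → H (u , i) (v , j) ≡ true → G u v ≡ true
    matching : ∀ u v i j j′ → G u v ≡ true →
               H (u , i) (v , j) ≡ true → H (u , i) (v , j′) ≡ true → j ≡ j′

deleteBetween : {n m : ℕ} → CoverGraph n m → Fin n → Fin n → CoverGraph n m
deleteBetween H u v (x , i) (y , j) =
  H (x , i) (y , j) ∧ not ((⌊ x ≟ u ⌋ ∧ ⌊ y ≟ v ⌋) ∨ (⌊ x ≟ v ⌋ ∧ ⌊ y ≟ u ⌋))

Subset : ℕ → ℕ → Set
Subset n m = Fin n → Fin m → Bool

bit : Bool → ℕ
bit true  = 1
bit false = 0

size : {n m : ℕ} → Subset n m → ℕ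
size {n} {m} S = sum (map (λ u → sum (map (λ i → bit (S u i)) (allFin m))) (allFin n))

isIndependent : {n m : ℕ} → CoverGraph n m → Subset n m → Bool
isIndependent {n} {m} H S =
  allB (allFin n) λ x → allB (allFin m) λ i →
  allB (allFin n) λ y → allB (allFin m) λ j →
    not (S x i ∧ S y j ∧ H (x , i) (y , j))

isHColoring : {n m : ℕ} → CoverGraph n m → Subset n m → Bool
isHColoring {n} H S = isIndependent H S ∧ ⌊ Data.Nat._≟_ (size S) n ⌋
  where import Data.Nat

allSubsets : (n m : ℕ) → List (Subset n m)
allSubsets n m = allFuns n (allFuns m (true ∷ false ∷ []))

PDP : {n m : ℕ} → CoverGraph n m → ℕ
PDP {n} {m} H = count (isHColoring H) (allSubsets n m)

-- "Natural bijection" condition: the elements of each L(v) can be named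
-- L(v) = {(v, σ_v j) : j ∈ [m]} (σ_v a bijection [m] → L(v)) so that
-- whenever xy ∈ E(G), (x,σ_x j) and (y,σ_y j) are adjacent in H for all j.

NaturalBijection : {n m : ℕ} → Graph n → CoverGraph n m → Set
NaturalBijection {n} {m} G H =
  Data.Product.Σ (Fin n → Permutation′ m) λ σ →
    ∀ x y → G x y ≡ true → ∀ j → H (x , σ x ⟨$⟩ʳ j) (y , σ y ⟨$⟩ʳ j) ≡ true
  where import Data.Product

bound : (A B : ℕ) (m : ℕ) → 2 ≤ m → ℚ
bound A B (suc (suc k)) _ =
  (+ A / 1) - (((+ A / 1) - (+ B / 1)) ⊔ (+ B / suc k))
bound A B (suc zero) (s≤s ())

module Submission where

-- Write G' = G - e, m = k + 2 and, for colours a b, let N a b be the number of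
-- proper m-colourings c of G' with c u = a and c v = b.  The development:
--  * Counting: finite sums ∑, the counting function of Defs, and counting by
--    injections (a pigeonhole principle) over the duplicate-free enumerations
--    allFuns, whose entries are functions compared pointwise.
--  * DP-colourings of an m-fold cover K are the graphs {(x , c x)} of colourings c
--    that are independent in K (PDP-as-colourings).
--  * Permuting colours preserves properness, so N a a = n₁ and N a b = n₂ (a ≠ b)
--    are constants; hence P(G', m) = m·n₁ + P(G, m) and P(G, m) = m(m-1)·n₂, and
--    the bound of the lemma equals P(G', m) - m·max(n₁, n₂) (bound-value).
--  * If H is natural on G' via names σ, its DP-colourings are the proper
--    colourings of G' avoiding the matching E between L(u) and L(v) at (u , v);
--    a matching removes at most m·max(n₁, n₂) of them (PDP-lower-bound).
--  * The cover H* that is natural on G' and joins (u , a) to (v , τ a) removes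
--    exactly ∑ₐ N a (τ a); τ = identity (if n₁ ≥ n₂) or a cyclic rotation (if
--    n₁ ≤ n₂) removes m·max(n₁, n₂), so the bound is attained (PDP-attained).

open import Defs
open import Level using (0ℓ)
open import Function using (_∘_; Equivalence)
open import Data.Bool using (Bool; true; false; _∧_; _∨_; not; if_then_else_; T; T?)
import Data.Bool as Bool
open import Data.Bool.Properties using (T-≡)
import Data.Bool.Properties as BoolP
open import Data.Nat using (ℕ; zero; suc; _+_; _*_; _∸_; _≤_; s≤s; z≤n; _⊔_)
import Data.Nat as ℕ
import Data.Nat.Properties as ℕP
open import Algebra.Properties.CommutativeSemigroup ℕP.+-commutativeSemigroup
  using () renaming (interchange to +-interchange)
open import Data.Nat.ListAction using (sum)
open import Data.Integer using (+_)
import Data.Integer as ℤ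
import Data.Integer.Properties as ℤP
open import Data.Rational using (ℚ; mkℚ; _/_; _-_; 0ℚ) renaming (_≤_ to _≤ℚ_; _+_ to _+ℚ_; _⊔_ to _⊔ℚ_)
import Data.Rational as ℚ
import Data.Rational.Properties as ℚP
import Data.Rational.Unnormalised as ℚᵘ
import Data.Nat.Coprimality as Coprimality
open import Data.Fin using (Fin; zero; suc; _≟_)
open import Data.Fin.Properties using (any?; suc-injective)
open import Data.Fin.Permutation using (Permutation′; _⟨$⟩ʳ_; _⟨$⟩ˡ_; inverseˡ; inverseʳ; transpose)
import Data.Fin.Permutation as Perm
open import Data.List using (List; []; _∷_; map; length; filterᵇ; allFin; concatMap)
open import Data.List.Properties using (length-removeAt′; map-tabulate; map-cong)
open import Data.List.Relation.Unary.Any using (here; there; index)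
import Data.List.Relation.Unary.Any as Any
open import Data.List.Relation.Unary.All using ([]; _∷_)
open import Data.List.Relation.Unary.AllPairs using ([]; _∷_)
import Data.List.Membership.Setoid as Membership
import Data.List.Membership.Setoid.Properties as MembershipP
import Data.List.Membership.Propositional as PropMembership
open import Data.List.Membership.Propositional.Properties using (∈-allFin)
open import Data.List.Relation.Unary.Unique.Setoid using (Unique)
import Data.List.Relation.Unary.Unique.Setoid.Properties as UniqueP
open import Data.List.Relation.Unary.Unique.Propositional.Properties using (allFin⁺)
import Data.Vec.Functional.Relation.Binary.Equality.Setoid as Pointwise
open import Data.Vec.Functional using () renaming (_∷_ to _∷ᶠ_)
open import Data.Empty using (⊥-elim)
open import Data.Product using (Σ; ∃; _×_; _,_; proj₁; proj₂)
open import Data.Sum using (_⊎_; inj₁; inj₂)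
open import Relation.Nullary using (¬_; Dec; yes; no)
open import Relation.Nullary.Decidable using (⌊_⌋; toWitness; fromWitness; fromWitnessFalse; dec-true; dec-false)
open import Relation.Binary.Bundles using (Setoid)
open import Relation.Binary.PropositionalEquality
  using (_≡_; _≢_; refl; sym; trans; cong; cong₂; subst; subst₂; setoid; module ≡-Reasoning)

false≢true : false ≢ true
false≢true ()

∧-true : ∀ {a b} → a ∧ b ≡ true → a ≡ true × b ≡ true
∧-true {true} {true} _ = refl , refl

∧-intro : ∀ {a b} → a ≡ true → b ≡ true → a ∧ b ≡ true
∧-intro refl refl = refl

∨-introˡ : ∀ {a} b → a ≡ true → a ∨ b ≡ true
∨-introˡ b refl = refl

∨-introʳ : ∀ a {b} → b ≡ true → a ∨ b ≡ true
∨-introʳ true  _ = refl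
∨-introʳ false e = e

∨-true : ∀ {a b} → a ∨ b ≡ true → a ≡ true ⊎ b ≡ true
∨-true {true}         _ = inj₁ refl
∨-true {false} {true} _ = inj₂ refl

not-true : ∀ {a} → not a ≡ true → a ≡ false
not-true {false} _ = refl

∧-false : ∀ {a b} → a ∧ b ≡ false → a ≡ true → b ≡ false
∧-false {true} a∧b≡false refl = a∧b≡false

bit-if : ∀ b → bit b ≡ (if b then 1 else 0)
bit-if true  = refl
bit-if false = refl

T⇒≡ : ∀ {b} → T b → b ≡ true
T⇒≡ = Equivalence.to T-≡

≡⇒T : ∀ {b} → b ≡ true → T b
≡⇒T = Equivalence.from T-≡

bool-ext : ∀ {a b} → (a ≡ true → b ≡ true) → (b ≡ true → a ≡ true) → a ≡ b
bool-ext {true}  {true}  _ _ = refl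
bool-ext {true}  {false} f _ = sym (f refl)
bool-ext {false} {true}  _ g = g refl
bool-ext {false} {false} _ _ = refl

⌊⌋-true : ∀ {A : Set} (a? : Dec A) → A → ⌊ a? ⌋ ≡ true
⌊⌋-true _ a = T⇒≡ (fromWitness a)

⌊⌋-false : ∀ {A : Set} (a? : Dec A) → ¬ A → ⌊ a? ⌋ ≡ false
⌊⌋-false _ ¬a = not-true (T⇒≡ (fromWitnessFalse ¬a))

⌊⌋-sound : ∀ {A : Set} (a? : Dec A) → ⌊ a? ⌋ ≡ true → A
⌊⌋-sound _ e = toWitness (≡⇒T e)

≟-refl : ∀ {m} (c : Fin m) → ⌊ c ≟ c ⌋ ≡ true
≟-refl c = ⌊⌋-true (c ≟ c) refl

≟-≢ : ∀ {m} {c a : Fin m} → c ≢ a → ⌊ c ≟ a ⌋ ≡ false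
≟-≢ {c = c} {a} = ⌊⌋-false (c ≟ a)

≟-sound : ∀ {m} {c a : Fin m} → ⌊ c ≟ a ⌋ ≡ true → c ≡ a
≟-sound {c = c} {a} = ⌊⌋-sound (c ≟ a)

≟-injective : ∀ {m} (f : Fin m → Fin m) → (∀ {a b} → f a ≡ f b → a ≡ b) →
              ∀ a b → ⌊ f a ≟ f b ⌋ ≡ ⌊ a ≟ b ⌋
≟-injective f f-inj a b with a ≟ b
... | yes refl = ≟-refl (f a)
... | no a≢b   = ≟-≢ (a≢b ∘ f-inj)

-- Finite sums  ∑ m f = f 0 + … + f (m-1),  written exactly as in Defs.size.

∑ : (m : ℕ) → (Fin m → ℕ) → ℕ
∑ m f = sum (map f (allFin m))

∑-suc : ∀ m (f : Fin (suc m) → ℕ) → ∑ (suc m) f ≡ f zero + ∑ m (f ∘ suc)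
∑-suc m f = cong (λ xs → f zero + sum xs)
  (trans (map-tabulate suc f) (sym (map-tabulate (λ i → i) (f ∘ suc))))

∑-cong : ∀ m {f g : Fin m → ℕ} → (∀ a → f a ≡ g a) → ∑ m f ≡ ∑ m g
∑-cong m f≗g = cong sum (map-cong f≗g (allFin m))

∑-const : ∀ m c → ∑ m (λ _ → c) ≡ m * c
∑-const zero    c = refl
∑-const (suc m) c = trans (∑-suc m _) (cong (_+_ c) (∑-const m c))

∑-zero : ∀ m → ∑ m (λ _ → 0) ≡ 0
∑-zero m = trans (∑-const m 0) (ℕP.*-zeroʳ m)

∑-+ : ∀ m (f g : Fin m → ℕ) → ∑ m (λ a → f a + g a) ≡ ∑ m f + ∑ m g
∑-+ zero    f g = refl
∑-+ (suc m) f g = begin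
  ∑ (suc m) (λ a → f a + g a)                       ≡⟨ ∑-suc m _ ⟩
  (f zero + g zero) + ∑ m (λ a → f (suc a) + g (suc a)) ≡⟨ cong (_+_ (f zero + g zero)) (∑-+ m (f ∘ suc) (g ∘ suc)) ⟩
  (f zero + g zero) + (∑ m (f ∘ suc) + ∑ m (g ∘ suc))  ≡⟨ +-interchange (f zero) (g zero) _ _ ⟩
  (f zero + ∑ m (f ∘ suc)) + (g zero + ∑ m (g ∘ suc))  ≡⟨ sym (cong₂ _+_ (∑-suc m f) (∑-suc m g)) ⟩
  ∑ (suc m) f + ∑ (suc m) g                            ∎
  where open ≡-Reasoning

∑-mono : ∀ m {f g : Fin m → ℕ} → (∀ a → f a ≤ g a) → ∑ m f ≤ ∑ m g
∑-mono zero    f≤g = z≤n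
∑-mono (suc m) {f} {g} f≤g = subst₂ _≤_ (sym (∑-suc m f)) (sym (∑-suc m g))
  (ℕP.+-mono-≤ (f≤g zero) (∑-mono m (f≤g ∘ suc)))

∑-indicator : ∀ m (c : Fin m) (h : Fin m → ℕ) → ∑ m (λ a → if ⌊ c ≟ a ⌋ then h a else 0) ≡ h c
∑-indicator (suc m) zero h =
  trans (∑-suc m _) (trans (cong (_+_ (h zero)) (∑-zero m)) (ℕP.+-identityʳ (h zero)))
∑-indicator (suc m) (suc c) h = trans (∑-suc m (λ a → if ⌊ suc c ≟ a ⌋ then h a else 0))
  (trans (∑-cong m shift) (∑-indicator m c (h ∘ suc)))
  where
  shift : ∀ a → (if ⌊ suc c ≟ suc a ⌋ then h (suc a) else 0) ≡ (if ⌊ c ≟ a ⌋ then h (suc a) else 0)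
  shift a with c ≟ a
  ... | yes _ = refl
  ... | no _  = refl

∑-complement : ∀ m (c : Fin m) (h : Fin m → ℕ) → ∑ m (λ a → if not ⌊ c ≟ a ⌋ then h a else 0) + h c ≡ ∑ m h
∑-complement m c h = begin
  ∑ m (λ a → if not ⌊ c ≟ a ⌋ then h a else 0) + h c
    ≡⟨ cong (_+_ (∑ m (λ a → if not ⌊ c ≟ a ⌋ then h a else 0))) (sym (∑-indicator m c h)) ⟩
  ∑ m (λ a → if not ⌊ c ≟ a ⌋ then h a else 0) + ∑ m (λ a → if ⌊ c ≟ a ⌋ then h a else 0)
    ≡⟨ sym (∑-+ m _ _) ⟩
  ∑ m (λ a → (if not ⌊ c ≟ a ⌋ then h a else 0) + (if ⌊ c ≟ a ⌋ then h a else 0))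
    ≡⟨ ∑-cong m split ⟩
  ∑ m h ∎
  where
  open ≡-Reasoning
  split : ∀ a → (if not ⌊ c ≟ a ⌋ then h a else 0) + (if ⌊ c ≟ a ⌋ then h a else 0) ≡ h a
  split a with ⌊ c ≟ a ⌋
  ... | true  = refl
  ... | false = ℕP.+-identityʳ (h a)

∑-atMostOne : ∀ m (E : Fin m → Bool) (N : Fin m → ℕ) (M : ℕ) → (∀ b → N b ≤ M) →
  (∀ {b b'} → E b ≡ true → E b' ≡ true → b ≡ b') → ∑ m (λ b → if E b then N b else 0) ≤ M
∑-atMostOne zero    E N M N≤M one = z≤n
∑-atMostOne (suc m) E N M N≤M one rewrite ∑-suc m (λ b → if E b then N b else 0) with E zero in E0
... | true  = subst (_≤ M) (sym (trans (cong (_+_ (N zero)) rest-zero) (ℕP.+-identityʳ _))) (N≤M zero)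
  where
  rest-zero : ∑ m (λ b → if E (suc b) then N (suc b) else 0) ≡ 0
  rest-zero = trans (∑-cong m outside) (∑-zero m)
    where
    outside : ∀ b → (if E (suc b) then N (suc b) else 0) ≡ 0
    outside b with E (suc b) in Eb
    ... | true  with () ← one E0 Eb
    ... | false = refl
... | false = ∑-atMostOne m (E ∘ suc) (N ∘ suc) M (N≤M ∘ suc) (λ e e' → suc-injective (one e e'))

∑-allOne : ∀ n (r : Fin n → ℕ) → (∀ x → r x ≤ 1) → ∑ n r ≡ n → ∀ x → r x ≡ 1
∑-allOne (suc n) r r≤1 total = λ
  { zero    → proj₁ head-and-rest
  ; (suc x) → ∑-allOne n (r ∘ suc) (r≤1 ∘ suc) (proj₂ head-and-rest) x }
  where
  rest≤n : ∑ n (r ∘ suc) ≤ n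
  rest≤n = subst (∑ n (r ∘ suc) ≤_) (trans (∑-const n 1) (ℕP.*-identityʳ n)) (∑-mono n (r≤1 ∘ suc))
  split : ∀ h t → h ≤ 1 → t ≤ n → h + t ≡ suc n → h ≡ 1 × t ≡ n
  split zero          t _        t≤n e = ⊥-elim (ℕP.1+n≰n (subst (_≤ n) e t≤n))
  split (suc zero)    t _        _   e = refl , ℕP.suc-injective e
  split (suc (suc _)) _ (s≤s ()) _   _
  head-and-rest : r zero ≡ 1 × ∑ n (r ∘ suc) ≡ n
  head-and-rest = split (r zero) _ (r≤1 zero) rest≤n (trans (sym (∑-suc n r)) total)

∑-bit-≟ : ∀ m (c : Fin m) → ∑ m (λ a → bit ⌊ c ≟ a ⌋) ≡ 1
∑-bit-≟ m c = trans (∑-cong m λ a → bit-if ⌊ c ≟ a ⌋) (∑-indicator m c (λ _ → 1))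

count-∷ : ∀ {A : Set} (p : A → Bool) x xs → count p (x ∷ xs) ≡ bit (p x) + count p xs
count-∷ p x xs with p x
... | true  = refl
... | false = refl

count-cong : ∀ {A : Set} {p q : A → Bool} xs → (∀ x → p x ≡ q x) → count p xs ≡ count q xs
count-cong []                 _   = refl
count-cong {p = p} {q} (x ∷ xs) p≗q = trans (count-∷ p x xs)
  (trans (cong₂ _+_ (cong bit (p≗q x)) (count-cong xs p≗q)) (sym (count-∷ q x xs)))

count-false : ∀ {A : Set} (p : A → Bool) xs → (∀ x → p x ≡ false) → count p xs ≡ 0
count-false p []       _     = refl
count-false p (x ∷ xs) never = trans (count-∷ p x xs) (cong₂ _+_ (cong bit (never x)) (count-false p xs never))

count-∧-const : ∀ {A : Set} (q r : A → Bool) (w : Bool) xs → (∀ x → r x ≡ true → q x ≡ w) →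
  count (λ x → q x ∧ r x) xs ≡ (if w then count r xs else 0)
count-∧-const q r true  xs q≡w = count-cong xs λ x → on-r x
  where
  on-r : ∀ x → q x ∧ r x ≡ r x
  on-r x with r x in rx
  ... | true  rewrite q≡w x rx = refl
  ... | false = BoolP.∧-zeroʳ (q x)
count-∧-const q r false xs q≡w = count-false _ xs λ x → off-r x
  where
  off-r : ∀ x → q x ∧ r x ≡ false
  off-r x with r x in rx
  ... | true  rewrite q≡w x rx = refl
  ... | false = BoolP.∧-zeroʳ (q x)

count-split : ∀ {A : Set} (p q : A → Bool) xs →
  count p xs ≡ count (λ x → p x ∧ q x) xs + count (λ x → p x ∧ not (q x)) xs
count-split p q []       = refl
count-split p q (x ∷ xs) with p x | q x
... | true  | true  = cong suc (count-split p q xs)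
... | true  | false = trans (cong suc (count-split p q xs)) (sym (ℕP.+-suc _ _))
... | false | _     = count-split p q xs

count-bucket : ∀ {A : Set} m (f : A → Fin m) (p : A → Bool) xs →
  count p xs ≡ ∑ m (λ a → count (λ x → p x ∧ ⌊ f x ≟ a ⌋) xs)
count-bucket m f p []       = sym (∑-zero m)
count-bucket m f p (x ∷ xs) = sym (begin
  ∑ m (λ a → count (λ y → p y ∧ ⌊ f y ≟ a ⌋) (x ∷ xs))
    ≡⟨ ∑-cong m (λ a → count-∷ (λ y → p y ∧ ⌊ f y ≟ a ⌋) x xs) ⟩
  ∑ m (λ a → bit (p x ∧ ⌊ f x ≟ a ⌋) + count (λ y → p y ∧ ⌊ f y ≟ a ⌋) xs)
    ≡⟨ ∑-+ m _ _ ⟩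
  ∑ m (λ a → bit (p x ∧ ⌊ f x ≟ a ⌋)) + ∑ m (λ a → count (λ y → p y ∧ ⌊ f y ≟ a ⌋) xs)
    ≡⟨ cong₂ _+_ head (sym (count-bucket m f p xs)) ⟩
  bit (p x) + count p xs
    ≡⟨ sym (count-∷ p x xs) ⟩
  count p (x ∷ xs) ∎)
  where
  open ≡-Reasoning
  head : ∑ m (λ a → bit (p x ∧ ⌊ f x ≟ a ⌋)) ≡ bit (p x)
  head with p x
  ... | true  = ∑-bit-≟ m (f x)
  ... | false = ∑-zero m

-- Counting by injections.  Lists are compared up to a setoid equality
-- (colourings and subsets are functions, compared pointwise).

module _ {ℓ₁ ℓ₂} (S : Setoid 0ℓ ℓ₁) (R : Setoid 0ℓ ℓ₂) where
  private
    module S = Setoid S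
    module R = Setoid R
  open Membership S using () renaming (_∈_ to _∈₁_)
  open Membership R using (_─_) renaming (_∈_ to _∈₂_)

  ∈-─ : ∀ {y z ys} (y∈ys : y ∈₂ ys) → z ∈₂ ys → ¬ z R.≈ y → z ∈₂ (ys ─ y∈ys)
  ∈-─ (here y≈w) (here z≈w) z≉y = ⊥-elim (z≉y (R.trans z≈w (R.sym y≈w)))
  ∈-─ (here _)   (there z∈) _   = z∈
  ∈-─ (there _)  (here z≈w) _   = here z≈w
  ∈-─ (there y∈) (there z∈) z≉y = there (∈-─ y∈ z∈ z≉y)

  pigeonhole : ∀ {xs ys} (f : S.Carrier → R.Carrier) → Unique S xs →
    (∀ {x} → x ∈₁ xs → f x ∈₂ ys) →
    (∀ {x x'} → x ∈₁ xs → x' ∈₁ xs → f x R.≈ f x' → x S.≈ x') →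
    length xs ≤ length ys
  pigeonhole f [] _ _ = z≤n
  pigeonhole {x ∷ xs} {ys} f (x∉xs ∷ xs!) into inj =
    subst (suc (length xs) ≤_) (sym (length-removeAt′ ys (index fx∈ys)))
      (s≤s (pigeonhole f xs! into′ (λ x∈ x'∈ → inj (there x∈) (there x'∈))))
    where
    fx∈ys : f x ∈₂ ys
    fx∈ys = into (here S.refl)
    into′ : ∀ {x'} → x' ∈₁ xs → f x' ∈₂ (ys ─ fx∈ys)
    into′ x'∈xs = ∈-─ fx∈ys (into (there x'∈xs)) λ fx'≈fx →
      MembershipP.All[≉]⇒∉ S x∉xs
        (MembershipP.∈-resp-≈ S (inj (there x'∈xs) (here S.refl) fx'≈fx) x'∈xs)

  count-≤ : ∀ {xs ys} (p : S.Carrier → Bool) (q : R.Carrier → Bool) (f : S.Carrier → R.Carrier) →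
    Unique S xs →
    (∀ {x x'} → x S.≈ x' → p x ≡ p x') → (∀ {y y'} → y R.≈ y' → q y ≡ q y') →
    (∀ {x} → x ∈₁ xs → p x ≡ true → f x ∈₂ ys × q (f x) ≡ true) →
    (∀ {x x'} → p x ≡ true → p x' ≡ true → f x R.≈ f x' → x S.≈ x') →
    count p xs ≤ count q ys
  count-≤ {xs} {ys} p q f xs! p-resp q-resp into inj =
    pigeonhole f (UniqueP.filter⁺ S (T? ∘ p) xs!) into′ λ x∈ x'∈ → inj (is-p x∈) (is-p x'∈)
    where
    ∈-filter⁻ : ∀ {x} → x ∈₁ filterᵇ p xs → x ∈₁ xs × T (p x)
    ∈-filter⁻ = MembershipP.∈-filter⁻ S (T? ∘ p) λ x≈x' → subst T (p-resp x≈x')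
    is-p : ∀ {x} → x ∈₁ filterᵇ p xs → p x ≡ true
    is-p x∈ = T⇒≡ (proj₂ (∈-filter⁻ x∈))
    into′ : ∀ {x} → x ∈₁ filterᵇ p xs → f x ∈₂ filterᵇ q ys
    into′ x∈ = MembershipP.∈-filter⁺ R (T? ∘ q) (λ y≈y' → subst T (q-resp y≈y'))
      (proj₁ (into (proj₁ (∈-filter⁻ x∈)) (is-p x∈)))
      (≡⇒T (proj₂ (into (proj₁ (∈-filter⁻ x∈)) (is-p x∈))))

module Enumeration {ℓ} (S : Setoid 0ℓ ℓ) where
  open Setoid S using (_≈_) renaming (Carrier to A; refl to ≈-refl; sym to ≈-sym)
  open Pointwise S using (≋-setoid)
  open Membership S using (_∈_)

  _∈ᶠ_ : ∀ {k} → (Fin k → A) → List (Fin k → A) → Set _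
  _∈ᶠ_ {k} = Membership._∈_ (≋-setoid k)

  allFuns-unique : ∀ k {xs} → Unique S xs → Unique (≋-setoid k) (allFuns k xs)
  allFuns-unique zero    _ = [] ∷ []
  allFuns-unique (suc k) {xs} xs! = blocks-unique xs!
    where
    block : A → List (Fin (suc k) → A)
    block a = map (a ∷ᶠ_) (allFuns k xs)
    block-head : ∀ {a v} → v ∈ᶠ block a → v zero ≈ a
    block-head v∈ = proj₂ (proj₂ (MembershipP.∈-map⁻ (≋-setoid k) (≋-setoid (suc k)) v∈)) zero
    blocks-head : ∀ {as v} → v ∈ᶠ concatMap block as → v zero ∈ as
    blocks-head {a ∷ as} v∈ with MembershipP.∈-++⁻ (≋-setoid (suc k)) (block a) v∈
    ... | inj₁ v∈a  = here (block-head v∈a)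
    ... | inj₂ v∈as = there (blocks-head v∈as)
    blocks-unique : ∀ {as} → Unique S as → Unique (≋-setoid (suc k)) (concatMap block as)
    blocks-unique []                    = []
    blocks-unique {a ∷ as} (a∉as ∷ as!) = UniqueP.++⁺ (≋-setoid (suc k))
      (UniqueP.map⁺ (≋-setoid k) (≋-setoid (suc k)) {f = a ∷ᶠ_} (λ e i → e (suc i)) (allFuns-unique k xs!))
      (blocks-unique as!)
      (λ (v∈a , v∈as) → MembershipP.All[≉]⇒∉ S a∉as
        (MembershipP.∈-resp-≈ S (block-head v∈a) (blocks-head v∈as)))

  allFuns-complete : ∀ k {xs} (g : Fin k → A) → (∀ i → g i ∈ xs) → g ∈ᶠ allFuns k xs
  allFuns-complete zero    g _   = here (λ ())
  allFuns-complete (suc k) {xs} g g∈ =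
    MembershipP.∈-concatMap⁺ S (≋-setoid (suc k)) (Any.map in-block (g∈ zero))
    where
    in-block : ∀ {a} → g zero ≈ a → g ∈ᶠ map (a ∷ᶠ_) (allFuns k xs)
    in-block g0≈a = MembershipP.∈-resp-≈ (≋-setoid (suc k)) (λ { zero → ≈-sym g0≈a ; (suc i) → ≈-refl })
      (MembershipP.∈-map⁺ (≋-setoid k) (≋-setoid (suc k)) (λ f≋g → λ { zero → ≈-refl ; (suc i) → f≋g i })
        (allFuns-complete k (g ∘ suc) (g∈ ∘ suc)))

allB-intro : ∀ {A : Set} (xs : List A) (p : A → Bool) → (∀ x → p x ≡ true) → allB xs p ≡ true
allB-intro []       p all-p = refl
allB-intro (x ∷ xs) p all-p rewrite all-p x = allB-intro xs p all-p

allB-elim : ∀ {A : Set} (xs : List A) (p : A → Bool) → allB xs p ≡ true →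
            ∀ {x} → x PropMembership.∈ xs → p x ≡ true
allB-elim (y ∷ xs) p h (here refl) = proj₁ (∧-true h)
allB-elim (y ∷ xs) p h (there x∈)  = allB-elim xs p (proj₂ (∧-true {p y} h)) x∈

allB-allFin : ∀ {n} (p : Fin n → Bool) → allB (allFin n) p ≡ true → ∀ x → p x ≡ true
allB-allFin p h x = allB-elim _ p h (∈-allFin x)

allB-cong : ∀ {A : Set} (xs : List A) {p q : A → Bool} → (∀ x → p x ≡ q x) → allB xs p ≡ allB xs q
allB-cong []       _   = refl
allB-cong (x ∷ xs) p≗q = cong₂ _∧_ (p≗q x) (allB-cong xs p≗q)

Colouring : ℕ → ℕ → Set
Colouring n m = Fin n → Fin m

colourings : (n m : ℕ) → List (Colouring n m)
colourings n m = allFuns n (allFin m)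

ColouringSetoid : ℕ → ℕ → Setoid 0ℓ 0ℓ
ColouringSetoid n m = Pointwise.≋-setoid (setoid (Fin m)) n

SubsetSetoid : ℕ → ℕ → Setoid 0ℓ 0ℓ
SubsetSetoid n m = Pointwise.≋-setoid (Pointwise.≋-setoid (setoid Bool) m) n

colourings-unique : ∀ n m → Unique (ColouringSetoid n m) (colourings n m)
colourings-unique n m = Enumeration.allFuns-unique (setoid (Fin m)) n (allFin⁺ m)

colourings-complete : ∀ {n m} (c : Colouring n m) → Enumeration._∈ᶠ_ (setoid (Fin m)) c (colourings n m)
colourings-complete c = Enumeration.allFuns-complete (setoid (Fin _)) _ c (∈-allFin ∘ c)

subsets-unique : ∀ n m → Unique (SubsetSetoid n m) (allSubsets n m)
subsets-unique n m = Enumeration.allFuns-unique (Pointwise.≋-setoid (setoid Bool) m) n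
  (Enumeration.allFuns-unique (setoid Bool) m (((λ ()) ∷ []) ∷ [] ∷ []))

subsets-complete : ∀ {n m} (S : Subset n m) →
  Enumeration._∈ᶠ_ (Pointwise.≋-setoid (setoid Bool) m) S (allSubsets n m)
subsets-complete {n} {m} S = Enumeration.allFuns-complete (Pointwise.≋-setoid (setoid Bool) m) n S
  λ x → Enumeration.allFuns-complete (setoid Bool) m (S x) λ i → bool∈ (S x i)
  where
  bool∈ : ∀ b → b PropMembership.∈ (true ∷ false ∷ [])
  bool∈ true  = here refl
  bool∈ false = there (here refl)

permutation-injective : ∀ {m} (π : Permutation′ m) {a b} → π ⟨$⟩ʳ a ≡ π ⟨$⟩ʳ b → a ≡ b
permutation-injective π {a} {b} e = trans (sym (inverseˡ π)) (trans (cong (π ⟨$⟩ˡ_) e) (inverseˡ π))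

transpose-left : ∀ {m} (i j : Fin m) → transpose i j ⟨$⟩ʳ i ≡ j
transpose-left i j rewrite dec-true (i ≟ i) refl = refl

transpose-other : ∀ {m} {i j k : Fin m} → k ≢ i → k ≢ j → transpose i j ⟨$⟩ʳ k ≡ k
transpose-other {i = i} {j} {k} k≢i k≢j rewrite dec-false (k ≟ i) k≢i | dec-false (k ≟ j) k≢j = refl

count-relabel : ∀ {n m} (σ : Fin n → Permutation′ m) (p : Colouring n m → Bool) →
  (∀ {c c'} → (∀ x → c x ≡ c' x) → p c ≡ p c') →
  count p (colourings n m) ≡ count (λ c → p (λ x → σ x ⟨$⟩ʳ c x)) (colourings n m)
count-relabel {n} {m} σ p p-resp = ℕP.≤-antisym
  (count-≤ Cols Cols p (p ∘ relabel) unrelabel (colourings-unique n m) p-resp (p-resp ∘ relabel-cong)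
    (λ {c} _ pc → colourings-complete (unrelabel c) , trans (p-resp λ x → inverseʳ (σ x)) pc)
    (λ _ _ e x → permutation-injective (Perm.flip (σ x)) (e x)))
  (count-≤ Cols Cols (p ∘ relabel) p relabel (colourings-unique n m) (p-resp ∘ relabel-cong) p-resp
    (λ {c} _ pc → colourings-complete (relabel c) , pc)
    (λ _ _ e x → permutation-injective (σ x) (e x)))
  where
  Cols : Setoid 0ℓ 0ℓ
  Cols = ColouringSetoid n m
  relabel unrelabel : Colouring n m → Colouring n m
  relabel   c x = σ x ⟨$⟩ʳ c x
  unrelabel c x = σ x ⟨$⟩ˡ c x
  relabel-cong : ∀ {c c'} → (∀ x → c x ≡ c' x) → ∀ x → relabel c x ≡ relabel c' x
  relabel-cong e x = cong (σ x ⟨$⟩ʳ_) (e x)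

proper-elim : ∀ {n m} (G : Graph n) (c : Colouring n m) → isProper G c ≡ true →
              ∀ x y → G x y ≡ true → c x ≢ c y
proper-elim G c proper x y Gxy cx≡cy = false≢true (trans
  (sym (∧-false (not-true (allB-allFin _ (allB-allFin _ proper x) y)) Gxy))
  (⌊⌋-true (c x ≟ c y) cx≡cy))

proper-intro : ∀ {n m} (G : Graph n) (c : Colouring n m) →
               (∀ x y → G x y ≡ true → c x ≢ c y) → isProper G c ≡ true
proper-intro {n} G c proper = allB-intro (allFin n) _ λ x → allB-intro (allFin n) _ λ y → edge-ok x y
  where
  edge-ok : ∀ x y → not (G x y ∧ ⌊ c x ≟ c y ⌋) ≡ true
  edge-ok x y with G x y in Gxy
  ... | false = refl
  ... | true rewrite ≟-≢ (proper x y Gxy) = refl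

proper-cong : ∀ {n m} (G : Graph n) {c c' : Colouring n m} → (∀ x → c x ≡ c' x) → isProper G c ≡ isProper G c'
proper-cong {n} G c≗c' = allB-cong (allFin n) λ x → allB-cong (allFin n) λ y →
  cong (λ z → not (G x y ∧ z)) (cong₂ (λ a b → ⌊ a ≟ b ⌋) (c≗c' x) (c≗c' y))

proper-permute : ∀ {n m} (G : Graph n) (π : Permutation′ m) (c : Colouring n m) →
  isProper G (λ x → π ⟨$⟩ʳ c x) ≡ isProper G c
proper-permute {n} G π c = allB-cong (allFin n) λ x → allB-cong (allFin n) λ y →
  cong (λ z → not (G x y ∧ z)) (≟-injective (π ⟨$⟩ʳ_) (permutation-injective π) (c x) (c y))

graphOf : ∀ {n m} → Colouring n m → Subset n m
graphOf c x i = ⌊ c x ≟ i ⌋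

size-graphOf : ∀ {n m} (c : Colouring n m) → size (graphOf c) ≡ n
size-graphOf {n} {m} c = trans (∑-cong n λ x → ∑-bit-≟ m (c x)) (trans (∑-const n 1) (ℕP.*-identityʳ n))

module _ {n m : ℕ} (K : CoverGraph n m) where

  independent-cong : ∀ {S S' : Subset n m} → (∀ x i → S x i ≡ S' x i) → isIndependent K S ≡ isIndependent K S'
  independent-cong S≗S' =
    allB-cong (allFin n) λ x → allB-cong (allFin m) λ i → allB-cong (allFin n) λ y → allB-cong (allFin m) λ j →
    cong not (cong₂ _∧_ (S≗S' x i) (cong (_∧ K (x , i) (y , j)) (S≗S' y j)))

  HColoring-cong : ∀ {S S' : Subset n m} → (∀ x i → S x i ≡ S' x i) → isHColoring K S ≡ isHColoring K S'
  HColoring-cong S≗S' = cong₂ _∧_ (independent-cong S≗S')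
    (cong (λ s → ⌊ s ℕ.≟ n ⌋) (∑-cong n λ x → ∑-cong m λ i → cong bit (S≗S' x i)))

  independent-elim : ∀ (S : Subset n m) → isIndependent K S ≡ true →
    ∀ x i y j → S x i ≡ true → S y j ≡ true → K (x , i) (y , j) ≡ false
  independent-elim S ind x i y j Sxi Syj =
    ∧-false (∧-false (not-true (allB-allFin _ (allB-allFin _ (allB-allFin _ (allB-allFin _ ind x) i) y) j)) Sxi) Syj

  independent-intro : ∀ (S : Subset n m) →
    (∀ x i y j → S x i ≡ true → S y j ≡ true → K (x , i) (y , j) ≡ false) → isIndependent K S ≡ true
  independent-intro S ok =
    allB-intro (allFin n) _ λ x → allB-intro (allFin m) _ λ i → allB-intro (allFin n) _ λ y → allB-intro (allFin m) _ λ j →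
    pair-ok x i y j
    where
    pair-ok : ∀ x i y j → not (S x i ∧ S y j ∧ K (x , i) (y , j)) ≡ true
    pair-ok x i y j with S x i in Sxi | S y j in Syj
    ... | false | _     = refl
    ... | true  | false = refl
    ... | true  | true rewrite ok x i y j Sxi Syj = refl

  independent-graph-elim : ∀ (c : Colouring n m) → isIndependent K (graphOf c) ≡ true →
    ∀ x y → K (x , c x) (y , c y) ≡ false
  independent-graph-elim c ind x y = independent-elim (graphOf c) ind x (c x) y (c y) (≟-refl (c x)) (≟-refl (c y))

  independent-graph-intro : ∀ (c : Colouring n m) → (∀ x y → K (x , c x) (y , c y) ≡ false) →
    isIndependent K (graphOf c) ≡ true
  independent-graph-intro c ok = independent-intro (graphOf c) λ x i y j cx≡i cy≡j →
    subst₂ (λ i j → K (x , i) (y , j) ≡ false) (≟-sound cx≡i) (≟-sound cy≡j) (ok x y)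

  HColoring-graphOf : ∀ (c : Colouring n m) → isHColoring K (graphOf c) ≡ isIndependent K (graphOf c)
  HColoring-graphOf c rewrite size-graphOf c | ⌊⌋-true (n ℕ.≟ n) refl = BoolP.∧-identityʳ _

-- DP-colourings of an m-fold cover are graphs of colourings: since every L(x) is a
-- clique, an H-colouring meets each L(x) at most once, and having size n it meets
-- each exactly once, at the colour chosen below.
module DPColourings {n m : ℕ} (K : CoverGraph n (suc m))
  (clique : ∀ u i j → i ≢ j → K (u , i) (u , j) ≡ true) where

  row-nonempty? : ∀ (S : Subset n (suc m)) x → Dec (∃ λ i → S x i ≡ true)
  row-nonempty? S x = any? λ i → S x i Bool.≟ true

  chosenColouring : Subset n (suc m) → Colouring n (suc m)
  chosenColouring S x with row-nonempty? S x
  ... | yes (i , _) = i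
  ... | no _        = zero

  chosen-true : ∀ S x → ∑ (suc m) (bit ∘ S x) ≢ 0 → S x (chosenColouring S x) ≡ true
  chosen-true S x nonempty with row-nonempty? S x
  ... | yes (_ , Sxi) = Sxi
  ... | no none = ⊥-elim (nonempty (trans (∑-cong (suc m) row-zero) (∑-zero (suc m))))
    where
    row-zero : ∀ i → bit (S x i) ≡ 0
    row-zero i with S x i in Sxi
    ... | true  = ⊥-elim (none (i , Sxi))
    ... | false = refl

  module _ (S : Subset n (suc m)) (hcol : isHColoring K S ≡ true) where
    private
      independent : isIndependent K S ≡ true
      independent = proj₁ (∧-true hcol)

      at-most-one : ∀ x {i j} → S x i ≡ true → S x j ≡ true → i ≡ j
      at-most-one x {i} {j} Sxi Sxj with i ≟ j
      ... | yes i≡j = i≡j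
      ... | no i≢j  = ⊥-elim (false≢true (trans (sym (independent-elim K S independent x i x j Sxi Sxj))
                                                (clique x i j i≢j)))

      row≡1 : ∀ x → ∑ (suc m) (bit ∘ S x) ≡ 1
      row≡1 = ∑-allOne n (λ x → ∑ (suc m) (bit ∘ S x))
        (λ x → subst (_≤ 1) (sym (∑-cong (suc m) (bit-if ∘ S x)))
                 (∑-atMostOne (suc m) (S x) _ 1 (λ _ → ℕP.≤-refl) (at-most-one x)))
        (⌊⌋-sound (size S ℕ.≟ n) (proj₂ (∧-true {isIndependent K S} hcol)))

      chosen-in-S : ∀ x → S x (chosenColouring S x) ≡ true
      chosen-in-S x = chosen-true S x λ row≡0 → ℕP.1+n≢0 (trans (sym (row≡1 x)) row≡0)

    HColoring-is-graph : ∀ x i → S x i ≡ graphOf (chosenColouring S) x i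
    HColoring-is-graph x i with chosenColouring S x ≟ i
    ... | yes refl = chosen-in-S x
    ... | no chosen≢i with S x i in Sxi
    ...   | false = refl
    ...   | true  = ⊥-elim (chosen≢i (at-most-one x (chosen-in-S x) Sxi))

  PDP-as-colourings : PDP K ≡ count (λ c → isIndependent K (graphOf c)) (colourings n (suc m))
  PDP-as-colourings = ℕP.≤-antisym
    (count-≤ Subsets Colourings (isHColoring K) independent-graph chosenColouring
      (subsets-unique n (suc m)) (HColoring-cong K) independent-graph-cong
      (λ {S} _ hcol → colourings-complete (chosenColouring S) ,
                       trans (sym (independent-cong K (HColoring-is-graph S hcol))) (proj₁ (∧-true hcol)))
      (λ {S} {S'} hS hS' chosen≗ x i → trans (HColoring-is-graph S hS x i)
         (trans (cong (λ z → ⌊ z ≟ i ⌋) (chosen≗ x)) (sym (HColoring-is-graph S' hS' x i)))))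
    (count-≤ Colourings Subsets independent-graph (isHColoring K) graphOf
      (colourings-unique n (suc m)) independent-graph-cong (HColoring-cong K)
      (λ {c} _ ind → subsets-complete (graphOf c) , trans (HColoring-graphOf K c) ind)
      (λ {c} {c'} _ _ graph≗ x → ≟-sound (trans (graph≗ x (c' x)) (≟-refl (c' x)))))
    where
    Subsets Colourings : Setoid 0ℓ 0ℓ
    Subsets    = SubsetSetoid n (suc m)
    Colourings = ColouringSetoid n (suc m)
    independent-graph : Colouring n (suc m) → Bool
    independent-graph c = isIndependent K (graphOf c)
    independent-graph-cong : ∀ {c c'} → (∀ x → c x ≡ c' x) → independent-graph c ≡ independent-graph c'
    independent-graph-cong c≗c' = independent-cong K λ x i → cong (λ z → ⌊ z ≟ i ⌋) (c≗c' x)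

onEdge : ∀ {n} → Fin n → Fin n → Fin n → Fin n → Bool
onEdge u v x y = (⌊ x ≟ u ⌋ ∧ ⌊ y ≟ v ⌋) ∨ (⌊ x ≟ v ⌋ ∧ ⌊ y ≟ u ⌋)

onEdge-cases : ∀ {n} (u v x y : Fin n) →
  onEdge u v x y ≡ false ⊎ (x ≡ u × y ≡ v) ⊎ (x ≡ v × y ≡ u)
onEdge-cases u v x y with x ≟ u | y ≟ v | x ≟ v | y ≟ u
... | yes x≡u | yes y≡v | _       | _       = inj₂ (inj₁ (x≡u , y≡v))
... | _       | _       | yes x≡v | yes y≡u = inj₂ (inj₂ (x≡v , y≡u))
... | yes _   | no _    | yes _   | no _    = inj₁ refl
... | yes _   | no _    | no _    | _       = inj₁ refl
... | no _    | _       | yes _   | no _    = inj₁ refl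
... | no _    | _       | no _    | _       = inj₁ refl

onEdge-uv : ∀ {n} (u v : Fin n) → onEdge u v u v ≡ true
onEdge-uv u v rewrite ≟-refl u | ≟-refl v = refl

onEdge-sym : ∀ {n} (u v x y : Fin n) → onEdge u v x y ≡ onEdge u v y x
onEdge-sym u v x y = trans (cong₂ _∨_ (BoolP.∧-comm ⌊ x ≟ u ⌋ _) (BoolP.∧-comm ⌊ x ≟ v ⌋ _))
  (BoolP.∨-comm (⌊ y ≟ v ⌋ ∧ ⌊ x ≟ u ⌋) _)

module _ {n : ℕ} (G : Graph n) (u v : Fin n) where

  deleteEdge-elim : ∀ {x y} → deleteEdge G u v x y ≡ true → G x y ≡ true × onEdge u v x y ≡ false
  deleteEdge-elim {x} {y} e = let (Gxy , off) = ∧-true {G x y} e in Gxy , not-true off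

  deleteEdge-intro : ∀ {x y} → G x y ≡ true → onEdge u v x y ≡ false → deleteEdge G u v x y ≡ true
  deleteEdge-intro Gxy off rewrite Gxy | off = refl

  deleteEdge-uv : deleteEdge G u v u v ≡ false
  deleteEdge-uv rewrite onEdge-uv u v = BoolP.∧-zeroʳ (G u v)

  proper-deleteEdge : G u v ≡ true → ∀ {m} (c : Colouring n m) →
    isProper G c ≡ isProper (deleteEdge G u v) c ∧ not ⌊ c u ≟ c v ⌋
  proper-deleteEdge Guv c = bool-ext
    (λ proper → cong₂ _∧_
      (proper-intro _ c λ x y G'xy → proper-elim G c proper x y (proj₁ (deleteEdge-elim G'xy)))
      (cong not (≟-≢ (proper-elim G c proper u v Guv))))
    (λ proper′ → let (proper' , separated) = ∧-true proper′ in
      proper-intro G c (case-edge proper' λ cu≡cv →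
        false≢true (trans (sym (not-true separated)) (⌊⌋-true (c u ≟ c v) cu≡cv))))
    where
    case-edge : isProper (deleteEdge G u v) c ≡ true → c u ≢ c v → ∀ x y → G x y ≡ true → c x ≢ c y
    case-edge proper' cu≢cv x y Gxy with onEdge-cases u v x y
    ... | inj₁ off                   = proper-elim _ c proper' x y (deleteEdge-intro Gxy off)
    ... | inj₂ (inj₁ (refl , refl)) = cu≢cv
    ... | inj₂ (inj₂ (refl , refl)) = cu≢cv ∘ sym

module PairCounts {n k : ℕ} (G : Graph n) (u v : Fin n) (Guv : G u v ≡ true) where
  m : ℕ
  m = suc (suc k)

  G' : Graph n
  G' = deleteEdge G u v

  Cs : List (Colouring n m)
  Cs = colourings n m

  N : Fin m → Fin m → ℕ
  N a b = count (λ c → isProper G' c ∧ ⌊ c u ≟ a ⌋ ∧ ⌊ c v ≟ b ⌋) Cs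

  -- Renaming the colours by a permutation is a bijection on proper colourings.
  N-permute : (π : Permutation′ m) → ∀ a b → N (π ⟨$⟩ʳ a) (π ⟨$⟩ʳ b) ≡ N a b
  N-permute π a b = trans (count-relabel (λ _ → π) Q Q-resp) (count-cong Cs λ c →
    cong₂ _∧_ (proper-permute G' π c) (cong₂ _∧_ (π-≟ (c u) a) (π-≟ (c v) b)))
    where
    Q : Colouring n m → Bool
    Q c = isProper G' c ∧ ⌊ c u ≟ π ⟨$⟩ʳ a ⌋ ∧ ⌊ c v ≟ π ⟨$⟩ʳ b ⌋
    Q-resp : ∀ {c c'} → (∀ x → c x ≡ c' x) → Q c ≡ Q c'
    Q-resp c≗c' = cong₂ _∧_ (proper-cong G' c≗c')
      (cong₂ _∧_ (cong (λ z → ⌊ z ≟ _ ⌋) (c≗c' u)) (cong (λ z → ⌊ z ≟ _ ⌋) (c≗c' v)))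
    π-≟ : ∀ a b → ⌊ π ⟨$⟩ʳ a ≟ π ⟨$⟩ʳ b ⌋ ≡ ⌊ a ≟ b ⌋
    π-≟ = ≟-injective (π ⟨$⟩ʳ_) (permutation-injective π)

  -- Hence N takes one value on the diagonal and one value off it.
  n₁ n₂ : ℕ
  n₁ = N zero zero
  n₂ = N zero (suc zero)

  N-diagonal : ∀ a → N a a ≡ n₁
  N-diagonal a = subst (λ z → N z z ≡ n₁) (transpose-left zero a) (N-permute (transpose zero a) zero zero)

  N-offDiagonal : ∀ {a b} → a ≢ b → N a b ≡ n₂
  N-offDiagonal {a} {b} a≢b = trans
    (subst₂ (λ s t → N s t ≡ N a b') (transpose-other a≢b' a≢b) (transpose-left b' b) (N-permute (transpose b' b) a b'))
    (subst (λ z → N z b' ≡ n₂) (transpose-left zero a) (N-permute (transpose zero a) zero (suc zero)))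
    where
    b' : Fin m
    b' = transpose zero a ⟨$⟩ʳ suc zero
    a≢b' : a ≢ b'
    a≢b' a≡b' with permutation-injective (transpose zero a) {zero} {suc zero} (trans (transpose-left zero a) a≡b')
    ... | ()

  N≤max : ∀ a b → N a b ≤ n₁ ⊔ n₂
  N≤max a b with a ≟ b
  ... | yes refl = subst (_≤ n₁ ⊔ n₂) (sym (N-diagonal a)) (ℕP.m≤m⊔n n₁ n₂)
  ... | no a≢b   = subst (_≤ n₁ ⊔ n₂) (sym (N-offDiagonal a≢b)) (ℕP.m≤n⊔m n₁ n₂)

  count-by-pair : (W : Fin m → Fin m → Bool) →
    count (λ c → isProper G' c ∧ W (c u) (c v)) Cs ≡ ∑ m (λ a → ∑ m (λ b → if W a b then N a b else 0))
  count-by-pair W = begin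
    count Q Cs
      ≡⟨ count-bucket m (λ c → c u) Q Cs ⟩
    ∑ m (λ a → count (λ c → Q c ∧ ⌊ c u ≟ a ⌋) Cs)
      ≡⟨ ∑-cong m (λ a → count-bucket m (λ c → c v) _ Cs) ⟩
    ∑ m (λ a → ∑ m (λ b → count (λ c → (Q c ∧ ⌊ c u ≟ a ⌋) ∧ ⌊ c v ≟ b ⌋) Cs))
      ≡⟨ ∑-cong m (λ a → ∑-cong m (at-pair a)) ⟩
    ∑ m (λ a → ∑ m (λ b → if W a b then N a b else 0)) ∎
    where
    open ≡-Reasoning
    Q : Colouring n m → Bool
    Q c = isProper G' c ∧ W (c u) (c v)
    at-pair : ∀ a b → count (λ c → (Q c ∧ ⌊ c u ≟ a ⌋) ∧ ⌊ c v ≟ b ⌋) Cs ≡ (if W a b then N a b else 0)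
    at-pair a b = trans (count-cong Cs regroup)
      (count-∧-const (λ c → W (c u) (c v)) (λ c → isProper G' c ∧ ⌊ c u ≟ a ⌋ ∧ ⌊ c v ≟ b ⌋) (W a b) Cs
        λ c at → let (_ , at-u-v) = ∧-true {isProper G' c} at ; (at-u , at-v) = ∧-true at-u-v
                 in cong₂ W (≟-sound at-u) (≟-sound at-v))
      where
      regroup : ∀ c → (Q c ∧ ⌊ c u ≟ a ⌋) ∧ ⌊ c v ≟ b ⌋ ≡
                      W (c u) (c v) ∧ (isProper G' c ∧ ⌊ c u ≟ a ⌋ ∧ ⌊ c v ≟ b ⌋)
      regroup c = trans (BoolP.∧-assoc (Q c) _ _)
        (trans (cong (_∧ (⌊ c u ≟ a ⌋ ∧ ⌊ c v ≟ b ⌋)) (BoolP.∧-comm (isProper G' c) _))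
               (BoolP.∧-assoc (W (c u) (c v)) _ _))

  count-matching-≤ : (W : Fin m → Fin m → Bool) → (∀ {a b b'} → W a b ≡ true → W a b' ≡ true → b ≡ b') →
    count (λ c → isProper G' c ∧ W (c u) (c v)) Cs ≤ m * (n₁ ⊔ n₂)
  count-matching-≤ W matching = subst₂ _≤_ (sym (count-by-pair W)) (∑-const m (n₁ ⊔ n₂))
    (∑-mono m λ a → ∑-atMostOne m (W a) (N a) (n₁ ⊔ n₂) (N≤max a) matching)

  count-by-function : (τ : Fin m → Fin m) →
    count (λ c → isProper G' c ∧ ⌊ τ (c u) ≟ c v ⌋) Cs ≡ ∑ m (λ a → N a (τ a))
  count-by-function τ = trans (count-by-pair (λ a b → ⌊ τ a ≟ b ⌋)) (∑-cong m λ a → ∑-indicator m (τ a) (N a))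

  -- P(G - uv, m) = m·n₁ + P(G, m): colourings with c u = c v, and those of G.
  P-deleteEdge : P G' m ≡ m * n₁ + P G m
  P-deleteEdge = trans (count-split (isProper G') (λ c → ⌊ c u ≟ c v ⌋) Cs)
    (cong₂ _+_ diagonal (sym (count-cong Cs (proper-deleteEdge G u v Guv))))
    where
    diagonal : count (λ c → isProper G' c ∧ ⌊ c u ≟ c v ⌋) Cs ≡ m * n₁
    diagonal = trans (count-by-pair (λ a b → ⌊ a ≟ b ⌋))
      (trans (∑-cong m λ a → trans (∑-indicator m a (N a)) (N-diagonal a)) (∑-const m n₁))

  P-graph : P G m ≡ m * (suc k * n₂)
  P-graph = trans (count-cong Cs (proper-deleteEdge G u v Guv))
    (trans (count-by-pair (λ a b → not ⌊ a ≟ b ⌋)) (trans (∑-cong m row) (∑-const m (suc k * n₂))))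
    where
    row : ∀ a → ∑ m (λ b → if not ⌊ a ≟ b ⌋ then N a b else 0) ≡ suc k * n₂
    row a = ℕP.+-cancelʳ-≡ n₂ _ _ (begin
      ∑ m (λ b → if not ⌊ a ≟ b ⌋ then N a b else 0) + n₂ ≡⟨ cong (_+ n₂) (∑-cong m off-diagonal) ⟩
      ∑ m (λ b → if not ⌊ a ≟ b ⌋ then n₂ else 0) + n₂    ≡⟨ ∑-complement m a (λ _ → n₂) ⟩
      ∑ m (λ _ → n₂)                                      ≡⟨ ∑-const m n₂ ⟩
      n₂ + suc k * n₂                                     ≡⟨ ℕP.+-comm n₂ _ ⟩
      suc k * n₂ + n₂                                     ∎)
      where
      open ≡-Reasoning
      off-diagonal : ∀ b → (if not ⌊ a ≟ b ⌋ then N a b else 0) ≡ (if not ⌊ a ≟ b ⌋ then n₂ else 0)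
      off-diagonal b with a ≟ b
      ... | yes _  = refl
      ... | no a≢b = N-offDiagonal a≢b

-- A cover H of G that is natural on G - uv via names σ: in these names, the
-- H-colourings are the proper colourings c of G - uv for which (u , c u) and
-- (v , c v) are not joined by the remaining edges E between L(u) and L(v).
module NaturalCover {n m : ℕ} (G : Graph n) (u v : Fin n) (H : CoverGraph n (suc m)) (cover : IsCover G H)
  (σ : Fin n → Permutation′ (suc m))
  (natural : ∀ x y → deleteEdge G u v x y ≡ true → ∀ j →
             deleteBetween H u v (x , σ x ⟨$⟩ʳ j) (y , σ y ⟨$⟩ʳ j) ≡ true) where
  open IsCover cover using (irrefl; clique; respects; matching)

  G' : Graph n
  G' = deleteEdge G u v

  E : Fin (suc m) → Fin (suc m) → Bool
  E a b = H (u , σ u ⟨$⟩ʳ a) (v , σ v ⟨$⟩ʳ b)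

  E-matching : G u v ≡ true → ∀ {a b b'} → E a b ≡ true → E a b' ≡ true → b ≡ b'
  E-matching Guv Eab Eab' = permutation-injective (σ v) (matching u v _ _ _ Guv Eab Eab')

  private
    natural-H : ∀ x y → G' x y ≡ true → ∀ j → H (x , σ x ⟨$⟩ʳ j) (y , σ y ⟨$⟩ʳ j) ≡ true
    natural-H x y G'xy j = proj₁ (∧-true (natural x y G'xy j))

  relabel : Colouring n (suc m) → Colouring n (suc m)
  relabel c x = σ x ⟨$⟩ʳ c x

  independent-relabel : ∀ c → isIndependent H (graphOf (relabel c)) ≡ isProper G' c ∧ not (E (c u) (c v))
  independent-relabel c = bool-ext
    (λ ind → let no-edge = independent-graph-elim H (relabel c) ind in
      cong₂ _∧_ (proper-intro G' c λ x y G'xy cx≡cy → false≢true (trans (sym (no-edge x y))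
                   (subst (λ z → H (x , relabel c x) (y , σ y ⟨$⟩ʳ z) ≡ true) cx≡cy (natural-H x y G'xy (c x)))))
                (cong not (no-edge u v)))
    (λ ok → let (proper , not-E) = ∧-true ok in
      independent-graph-intro H (relabel c) (no-edge proper (not-true not-E)))
    where
    no-edge : isProper G' c ≡ true → E (c u) (c v) ≡ false → ∀ x y → H (x , relabel c x) (y , relabel c y) ≡ false
    no-edge proper ¬E x y with x ≟ y
    ... | yes refl = irrefl _
    ... | no x≢y with onEdge-cases u v x y
    ...   | inj₂ (inj₁ (refl , refl)) = ¬E
    ...   | inj₂ (inj₂ (refl , refl)) = trans (IsCover.sym cover _ _) ¬E
    ...   | inj₁ off with H (x , relabel c x) (y , relabel c y) in Hxy
    ...     | false = refl
    ...     | true  = ⊥-elim (proper-elim G' c proper x y G'xy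
                        (sym (permutation-injective (σ y) (matching x y _ _ _ Gxy Hxy (natural-H x y G'xy (c x))))))
      where
      Gxy : G x y ≡ true
      Gxy = respects x y _ _ x≢y Hxy
      G'xy : G' x y ≡ true
      G'xy = deleteEdge-intro G u v Gxy off

  PDP-natural : PDP H ≡ count (λ c → isProper G' c ∧ not (E (c u) (c v))) (colourings n (suc m))
  PDP-natural = trans (DPColourings.PDP-as-colourings H clique)
    (trans (count-relabel σ (λ c → isIndependent H (graphOf c))
             (λ c≗c' → independent-cong H λ x i → cong (λ z → ⌊ z ≟ i ⌋) (c≗c' x)))
           (count-cong (colourings n (suc m)) independent-relabel))

-- For an injective τ, the cover H* of G that is natural on G - uv (with trivial
-- names) and joins (u , i) to (v , τ i).
module MatchedCover {n m : ℕ} (G : Graph n) (simple : IsSimple G) (u v : Fin n) (Guv : G u v ≡ true)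
  (τ : Fin (suc m) → Fin (suc m)) (τ-injective : ∀ {a b} → τ a ≡ τ b → a ≡ b) where

  G' : Graph n
  G' = deleteEdge G u v

  private
    u≢v : u ≢ v
    u≢v refl = false≢true (trans (sym (IsSimple.irrefl simple u)) Guv)

    G'-sym : ∀ x y → G' x y ≡ G' y x
    G'-sym x y = cong₂ (λ a b → a ∧ not b) (IsSimple.sym simple x y) (onEdge-sym u v x y)

    G'-vu : G' v u ≡ false
    G'-vu = trans (G'-sym v u) (deleteEdge-uv G u v)

  arc : CoverGraph n (suc m)
  arc (x , i) (y , j) = (⌊ x ≟ y ⌋ ∧ not ⌊ i ≟ j ⌋)
                      ∨ ((G' x y ∧ ⌊ i ≟ j ⌋) ∨ (⌊ x ≟ u ⌋ ∧ ⌊ y ≟ v ⌋ ∧ ⌊ τ i ≟ j ⌋))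

  H* : CoverGraph n (suc m)
  H* a b = arc a b ∨ arc b a

  arc-cases : ∀ x i y j → arc (x , i) (y , j) ≡ true →
    (x ≡ y × i ≢ j) ⊎ (G' x y ≡ true × i ≡ j) ⊎ (x ≡ u × y ≡ v × τ i ≡ j)
  arc-cases x i y j e with ∨-true e
  ... | inj₁ inside = let (x≡y , i≢j) = ∧-true inside in
    inj₁ (≟-sound x≡y , λ i≡j → false≢true (trans (sym (not-true i≢j)) (⌊⌋-true (i ≟ j) i≡j)))
  ... | inj₂ e′ with ∨-true e′
  ...   | inj₁ along    = let (G'xy , i≡j) = ∧-true along in inj₂ (inj₁ (G'xy , ≟-sound i≡j))
  ...   | inj₂ matched = let (x≡u , rest) = ∧-true matched ; (y≡v , τi≡j) = ∧-true rest in
    inj₂ (inj₂ (≟-sound x≡u , ≟-sound y≡v , ≟-sound τi≡j))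

  arc-irreflexive : ∀ a → arc a a ≡ false
  arc-irreflexive (x , i) with arc (x , i) (x , i) in e
  ... | false = refl
  ... | true with arc-cases x i x i e
  ...   | inj₁ (_ , i≢i)                = ⊥-elim (i≢i refl)
  ...   | inj₂ (inj₁ (G'xx , _))        =
    ⊥-elim (false≢true (trans (sym (IsSimple.irrefl simple x)) (proj₁ (deleteEdge-elim G u v G'xx))))
  ...   | inj₂ (inj₂ (refl , u≡v , _)) = ⊥-elim (u≢v u≡v)

  H*-cases : ∀ x i y j → x ≢ y → H* (x , i) (y , j) ≡ true →
    (G' x y ≡ true × i ≡ j) ⊎ (x ≡ u × y ≡ v × τ i ≡ j) ⊎ (x ≡ v × y ≡ u × τ j ≡ i)
  H*-cases x i y j x≢y e with ∨-true e
  ... | inj₁ forward with arc-cases x i y j forward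
  ...   | inj₁ (x≡y , _) = ⊥-elim (x≢y x≡y)
  ...   | inj₂ (inj₁ p)  = inj₁ p
  ...   | inj₂ (inj₂ p)  = inj₂ (inj₁ p)
  H*-cases x i y j x≢y e | inj₂ backward with arc-cases y j x i backward
  ...   | inj₁ (y≡x , _)                 = ⊥-elim (x≢y (sym y≡x))
  ...   | inj₂ (inj₁ (G'yx , j≡i))       = inj₁ (trans (G'-sym x y) G'yx , sym j≡i)
  ...   | inj₂ (inj₂ (y≡u , x≡v , τj≡i)) = inj₂ (inj₂ (x≡v , y≡u , τj≡i))

  cover : IsCover G H*
  cover = record
    { sym      = λ a b → BoolP.∨-comm (arc a b) (arc b a)
    ; irrefl   = λ a → cong₂ _∨_ (arc-irreflexive a) (arc-irreflexive a)
    ; clique   = λ x i j i≢j → ∨-introˡ (arc (x , j) (x , i)) (∨-introˡ _ (∧-intro (≟-refl x) (cong not (≟-≢ i≢j))))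
    ; respects = respects
    ; matching = matching
    }
    where
    adjacent⇒distinct : ∀ {x y} → G x y ≡ true → x ≢ y
    adjacent⇒distinct {x} Gxy refl = false≢true (trans (sym (IsSimple.irrefl simple x)) Gxy)

    respects : ∀ x y i j → x ≢ y → H* (x , i) (y , j) ≡ true → G x y ≡ true
    respects x y i j x≢y e with H*-cases x i y j x≢y e
    ... | inj₁ (G'xy , _)                = proj₁ (deleteEdge-elim G u v G'xy)
    ... | inj₂ (inj₁ (refl , refl , _)) = Guv
    ... | inj₂ (inj₂ (refl , refl , _)) = trans (IsSimple.sym simple v u) Guv

    matching : ∀ x y i j j' → G x y ≡ true → H* (x , i) (y , j) ≡ true → H* (x , i) (y , j') ≡ true → j ≡ j'
    matching x y i j j' Gxy e e' with H*-cases x i y j (adjacent⇒distinct Gxy) e | H*-cases x i y j' (adjacent⇒distinct Gxy) e'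
    ... | inj₁ (_ , i≡j)                  | inj₁ (_ , i≡j')                   = trans (sym i≡j) i≡j'
    ... | inj₂ (inj₁ (_ , _ , τi≡j))      | inj₂ (inj₁ (_ , _ , τi≡j'))       = trans (sym τi≡j) τi≡j'
    ... | inj₂ (inj₂ (_ , _ , τj≡i))      | inj₂ (inj₂ (_ , _ , τj'≡i))       = τ-injective (trans τj≡i (sym τj'≡i))
    ... | inj₁ (G'uv , _)                 | inj₂ (inj₁ (refl , refl , _))     = ⊥-elim (false≢true (trans (sym (deleteEdge-uv G u v)) G'uv))
    ... | inj₁ (G'vu , _)                 | inj₂ (inj₂ (refl , refl , _))     = ⊥-elim (false≢true (trans (sym G'-vu) G'vu))
    ... | inj₂ (inj₁ (refl , refl , _))   | inj₁ (G'uv , _)                   = ⊥-elim (false≢true (trans (sym (deleteEdge-uv G u v)) G'uv))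
    ... | inj₂ (inj₂ (refl , refl , _))   | inj₁ (G'vu , _)                   = ⊥-elim (false≢true (trans (sym G'-vu) G'vu))
    ... | inj₂ (inj₁ (x≡u , _ , _))       | inj₂ (inj₂ (x≡v , _ , _))         = ⊥-elim (u≢v (trans (sym x≡u) x≡v))
    ... | inj₂ (inj₂ (x≡v , _ , _))       | inj₂ (inj₁ (x≡u , _ , _))         = ⊥-elim (u≢v (trans (sym x≡u) x≡v))

  natural : ∀ x y → G' x y ≡ true → ∀ j → deleteBetween H* u v (x , Perm.id ⟨$⟩ʳ j) (y , Perm.id ⟨$⟩ʳ j) ≡ true
  natural x y G'xy j = ∧-intro
    (∨-introˡ (arc (y , j) (x , j)) (∨-introʳ (⌊ x ≟ y ⌋ ∧ not ⌊ j ≟ j ⌋) (∨-introˡ _ (∧-intro G'xy (≟-refl j)))))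
                               (cong not (proj₂ (deleteEdge-elim G u v G'xy)))

  H*-uv : ∀ a b → H* (u , a) (v , b) ≡ ⌊ τ a ≟ b ⌋
  H*-uv a b = bool-ext
    (λ e → case-uv (H*-cases u a v b u≢v e))
    (λ τa≡b → ∨-introˡ (arc (v , b) (u , a)) (∨-introʳ (⌊ u ≟ v ⌋ ∧ not ⌊ a ≟ b ⌋)
                 (∨-introʳ (G' u v ∧ ⌊ a ≟ b ⌋) (∧-intro (≟-refl u) (∧-intro (≟-refl v) τa≡b)))))
    where
    case-uv : (G' u v ≡ true × a ≡ b) ⊎ (u ≡ u × v ≡ v × τ a ≡ b) ⊎ (u ≡ v × v ≡ u × τ b ≡ a) →
              ⌊ τ a ≟ b ⌋ ≡ true
    case-uv (inj₁ (G'uv , _))          = ⊥-elim (false≢true (trans (sym (deleteEdge-uv G u v)) G'uv))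
    case-uv (inj₂ (inj₁ (_ , _ , τa≡b))) = ⌊⌋-true (τ a ≟ b) τa≡b
    case-uv (inj₂ (inj₂ (u≡v , _ , _)))  = ⊥-elim (u≢v u≡v)

  PDP-matched : PDP H* ≡ count (λ c → isProper G' c ∧ not ⌊ τ (c u) ≟ c v ⌋) (colourings n (suc m))
  PDP-matched = trans (NaturalCover.PDP-natural G u v H* cover (λ _ → Perm.id) natural)
    (count-cong (colourings n (suc m)) λ c → cong (λ b → isProper G' c ∧ not b) (H*-uv (c u) (c v)))

-- The cyclic shift i ↦ i + 1 (mod k + 1), a permutation without fixed points
-- when k ≥ 1.

shiftUp : ∀ {k} → Fin (suc k) → Fin (suc (suc k))
shiftUp zero    = zero
shiftUp (suc j) = suc (suc j)

rotate : ∀ {k} → Fin (suc k) → Fin (suc k)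
rotate {zero}  zero    = zero
rotate {suc k} zero    = suc zero
rotate {suc k} (suc i) = shiftUp (rotate i)

shiftUp-injective : ∀ {k} {a b : Fin (suc k)} → shiftUp a ≡ shiftUp b → a ≡ b
shiftUp-injective {a = zero}  {zero}  _    = refl
shiftUp-injective {a = suc a} {suc b} refl = refl

shiftUp≢1 : ∀ {k} (a : Fin (suc k)) → shiftUp a ≢ suc zero
shiftUp≢1 zero    ()
shiftUp≢1 (suc a) ()

rotate-injective : ∀ {k} {a b : Fin (suc k)} → rotate a ≡ rotate b → a ≡ b
rotate-injective {zero}  {zero}  {zero}  _ = refl
rotate-injective {suc k} {zero}  {zero}  _ = refl
rotate-injective {suc k} {zero}  {suc b} e = ⊥-elim (shiftUp≢1 (rotate b) (sym e))
rotate-injective {suc k} {suc a} {zero}  e = ⊥-elim (shiftUp≢1 (rotate a) e)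
rotate-injective {suc k} {suc a} {suc b} e = cong suc (rotate-injective (shiftUp-injective e))

rotate-fixedPointFree : ∀ {k} (i : Fin (suc (suc k))) → rotate i ≢ i
rotate-fixedPointFree zero ()
rotate-fixedPointFree {zero}  (suc zero) ()
rotate-fixedPointFree {suc k} (suc i) e with rotate i in ri
rotate-fixedPointFree {suc k} (suc i) () | zero
rotate-fixedPointFree {suc k} (suc i) refl | suc j = rotate-fixedPointFree i ri

ι : ℕ → ℚ
ι x = + x / 1

ι-mkℚ : ∀ x → ι x ≡ mkℚ (+ x) 0 (Coprimality.sym (Coprimality.1-coprimeTo x))
ι-mkℚ x = ℚP.normalize-coprime (Coprimality.sym (Coprimality.1-coprimeTo x))

ι-+ : ∀ x y → ι x +ℚ ι y ≡ ι (x + y)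
ι-+ x y rewrite ι-mkℚ x | ι-mkℚ y =
  cong (_/ 1) (cong₂ ℤ._+_ (ℤP.*-identityʳ (+ x)) (ℤP.*-identityʳ (+ y)))

ι-minus : ∀ x y → ι (x + y) - ι y ≡ ι x
ι-minus x y = begin
  ι (x + y) - ι y              ≡⟨ cong (_- ι y) (sym (ι-+ x y)) ⟩
  (ι x +ℚ ι y) +ℚ ℚ.- ι y      ≡⟨ ℚP.+-assoc (ι x) (ι y) (ℚ.- ι y) ⟩
  ι x +ℚ (ι y +ℚ ℚ.- ι y)      ≡⟨ cong (ι x +ℚ_) (ℚP.+-inverseʳ (ι y)) ⟩
  ι x +ℚ 0ℚ                    ≡⟨ ℚP.+-identityʳ (ι x) ⟩
  ι x                          ∎
  where open ≡-Reasoning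

ι-mono : ∀ {x y} → x ≤ y → ι x ≤ℚ ι y
ι-mono {x} {y} x≤y rewrite ι-mkℚ x | ι-mkℚ y =
  ℚ.*≤* (subst₂ ℤ._≤_ (sym (ℤP.*-identityʳ (+ x))) (sym (ℤP.*-identityʳ (+ y))) (ℤ.+≤+ x≤y))

ι-⊔ : ∀ x y → ι x ⊔ℚ ι y ≡ ι (x ⊔ y)
ι-⊔ x y with ℕP.≤-total x y
... | inj₁ x≤y = trans (ℚP.p≤q⇒p⊔q≡q (ι-mono x≤y)) (cong ι (sym (ℕP.m≤n⇒m⊔n≡n x≤y)))
... | inj₂ y≤x = trans (ℚP.p≥q⇒p⊔q≡p (ι-mono y≤x)) (cong ι (sym (ℕP.m≥n⇒m⊔n≡m y≤x)))

ι-divide : ∀ y k → + (y * suc k) / suc k ≡ ι y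
ι-divide y k = ℚP.fromℚᵘ-cong {ℚᵘ.mkℚᵘ (+ (y * suc k)) k} {ℚᵘ.mkℚᵘ (+ y) 0}
  (ℚᵘ.*≡* (trans (ℤP.*-identityʳ (+ (y * suc k))) (ℤP.pos-* y (suc k))))

bound-as-ℕ : ∀ {k A B} (X Y : ℕ) (m≥2 : 2 ≤ suc (suc k)) → A ≡ X + B → B ≡ Y * suc k →
  bound A B (suc (suc k)) m≥2 ≡ ι (A ∸ (X ⊔ Y))
bound-as-ℕ {k} {A} {B} X Y _ refl refl = begin
  ι A - ((ι A - ι B) ⊔ℚ (+ B / suc k)) ≡⟨ cong₂ (λ s t → ι A - (s ⊔ℚ t)) (ι-minus X B) (ι-divide Y k) ⟩
  ι A - (ι X ⊔ℚ ι Y)                   ≡⟨ cong (ι A -_) (ι-⊔ X Y) ⟩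
  ι A - ι (X ⊔ Y)                      ≡⟨ cong (λ z → ι z - ι (X ⊔ Y)) (sym (ℕP.m∸n+n≡m max≤A)) ⟩
  ι (A ∸ (X ⊔ Y) + (X ⊔ Y)) - ι (X ⊔ Y) ≡⟨ ι-minus (A ∸ (X ⊔ Y)) (X ⊔ Y) ⟩
  ι (A ∸ (X ⊔ Y))                      ∎
  where
  open ≡-Reasoning
  max≤A : X ⊔ Y ≤ A
  max≤A = ℕP.⊔-lub (ℕP.m≤m+n X B) (ℕP.≤-trans (ℕP.m≤m*n Y (suc k)) (ℕP.m≤n+m B X))

module Bounds {n k : ℕ} (G : Graph n) (simple : IsSimple G) (u v : Fin n) (Guv : G u v ≡ true) where
  open PairCounts {n} {k} G u v Guv

  bound-value : (m≥2 : 2 ≤ m) → bound (P G' m) (P G m) m m≥2 ≡ ι (P G' m ∸ m * (n₁ ⊔ n₂))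
  bound-value m≥2 = trans
    (bound-as-ℕ (m * n₁) (m * n₂) m≥2 P-deleteEdge
      (trans P-graph (trans (cong (m *_) (ℕP.*-comm (suc k) n₂)) (sym (ℕP.*-assoc m n₂ (suc k))))))
    (cong (λ z → ι (P G' m ∸ z)) (sym (ℕP.*-distribˡ-⊔ m n₁ n₂)))

  -- A cover natural on G - uv keeps all proper colourings of G - uv except those
  -- hit by the matching E at (u , v), at most m·max(n₁, n₂) of them.
  PDP-lower-bound : (H : CoverGraph n m) → IsCover G H → NaturalBijection G' (deleteBetween H u v) →
    P G' m ∸ m * (n₁ ⊔ n₂) ≤ PDP H
  PDP-lower-bound H cover (σ , natural) =
    subst (P G' m ∸ m * (n₁ ⊔ n₂) ≤_) (trans (cong (_∸ removed) split) (ℕP.m+n∸m≡n removed (PDP H)))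
      (ℕP.∸-monoʳ-≤ (P G' m) (count-matching-≤ E (E-matching Guv)))
    where
    open NaturalCover G u v H cover σ natural using (E; E-matching; PDP-natural)
    removed : ℕ
    removed = count (λ c → isProper G' c ∧ E (c u) (c v)) Cs
    split : P G' m ≡ removed + PDP H
    split = trans (count-split (isProper G') (λ c → E (c u) (c v)) Cs) (cong (_+_ removed) (sym PDP-natural))

  optimal-matching : Σ (Fin m → Fin m) λ τ →
    (∀ {a b} → τ a ≡ τ b → a ≡ b) × ∑ m (λ a → N a (τ a)) ≡ m * (n₁ ⊔ n₂)
  optimal-matching with ℕP.≤-total n₂ n₁
  ... | inj₁ n₂≤n₁ = (λ a → a) , (λ a≡b → a≡b) ,
    trans (∑-cong m N-diagonal) (trans (∑-const m n₁) (cong (m *_) (sym (ℕP.m≥n⇒m⊔n≡m n₂≤n₁))))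
  ... | inj₂ n₁≤n₂ = rotate , rotate-injective ,
    trans (∑-cong m λ a → N-offDiagonal (rotate-fixedPointFree a ∘ sym))
          (trans (∑-const m n₂) (cong (m *_) (sym (ℕP.m≤n⇒m⊔n≡n n₁≤n₂))))

  PDP-attained : Σ (CoverGraph n m) λ H* → IsCover G H* × PDP H* ≡ P G' m ∸ m * (n₁ ⊔ n₂)
  PDP-attained = H* , cover , (begin
    PDP H*                   ≡⟨ sym (ℕP.m+n∸m≡n removed (PDP H*)) ⟩
    removed + PDP H* ∸ removed ≡⟨ cong (_∸ removed) (sym split) ⟩
    P G' m ∸ removed         ≡⟨ cong (P G' m ∸_) (trans (count-by-function τ) τ-optimal) ⟩
    P G' m ∸ m * (n₁ ⊔ n₂)   ∎)
    where
    open ≡-Reasoning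
    τ : Fin m → Fin m
    τ = proj₁ optimal-matching
    τ-optimal : ∑ m (λ a → N a (τ a)) ≡ m * (n₁ ⊔ n₂)
    τ-optimal = proj₂ (proj₂ optimal-matching)
    open MatchedCover G simple u v Guv τ (proj₁ (proj₂ optimal-matching)) using (H*; cover; PDP-matched)
    removed : ℕ
    removed = count (λ c → isProper G' c ∧ ⌊ τ (c u) ≟ c v ⌋) Cs
    split : P G' m ≡ removed + PDP H*
    split = trans (count-split (isProper G') (λ c → ⌊ τ (c u) ≟ c v ⌋) Cs) (cong (_+_ removed) (sym PDP-matched))

lemma3p3 : {n m : ℕ} (G : Graph n) → IsSimple G → (m≥2 : 2 ≤ m) →
           (H : CoverGraph n m) → IsCover G H →
           (u v : Fin n) → G u v ≡ true →
           NaturalBijection (deleteEdge G u v) (deleteBetween H u v) →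
           (bound (P (deleteEdge G u v) m) (P G m) m m≥2 ≤ℚ + PDP H / 1)
           × Σ (CoverGraph n m) (λ H* → IsCover G H* ×
               (+ PDP H* / 1 ≡ bound (P (deleteEdge G u v) m) (P G m) m m≥2))
lemma3p3 {n} {suc (suc k)} G simple m≥2@(s≤s (s≤s z≤n)) H cover u v Guv natural =
  let (H* , H*-cover , PDP-H*) = PDP-attained in
  subst (_≤ℚ ι (PDP H)) (sym (bound-value m≥2)) (ι-mono (PDP-lower-bound H cover natural)) ,
  (H* , H*-cover , trans (cong ι PDP-H*) (sym (bound-value m≥2)))
  where open Bounds {k = k} G simple u v Guv using (bound-value; PDP-lower-bound; PDP-attained)
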